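{- There is an algorithm which, given an integer $d\ge 1$, outputs a mutual-visibility set of the hypercube $Q_d$ of cardinality greater than $\dfrac{2^{d}}{\sqrt{\frac{\pi}{2} d}}$.
   Context: For a connected graph $G$ and $X\subseteq V(G)$, two vertices $x,y\in V(G)$ are $X$-visible if there is a shortest $x,y$-path none of whose internal vertices lies in $X$. $X$ is a mutual-visibility set if every two vertices of $X$ are $X$-visible. The hypercube $Q_d$ has vertex set $\{0,1\}^d$, two binary strings being adjacent if and only if they differ in exactly one position. -}

module Defs where

open import Data.Bool using (Bool; true; false)
open import Data.Nat using (ℕ; zero; suc; _+_; _*_; _^_; _≤_)
open import Data.Vec using (Vec; []; _∷_)
open import Data.List using (List; []; _∷_; length)
open import Data.List.Membership.Propositional using (_∈_; _∉_)
open import Data.List.Relation.Unary.All using (All)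
open import Data.Product using (Σ; ∃; _×_)
open import Relation.Binary.PropositionalEquality using (_≡_)
open import Data.Integer using (+_)
open import Data.Rational as ℚ using (ℚ; _/_)

Vertex : ℕ → Set
Vertex d = Vec Bool d

differ : Bool → Bool → ℕ
differ true  true  = 0
differ false false = 0
differ _     _     = 1

hamming : ∀ {d} → Vertex d → Vertex d → ℕ
hamming []       []       = 0
hamming (a ∷ x)  (b ∷ y)  = differ a b + hamming x y

Adj : ∀ {d} → Vertex d → Vertex d → Set
Adj x y = hamming x y ≡ 1

data Walk {d : ℕ} : Vertex d → Vertex d → Set where
  stop : (x : Vertex d) → Walk x x
  step : (x : Vertex d) {y z : Vertex d} → Adj x y → Walk y z → Walk x z

len : ∀ {d} {x y : Vertex d} → Walk x y → ℕ
len (stop _)       = 0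
len (step _ _ w)   = suc (len w)

initV : ∀ {d} {x y : Vertex d} → Walk x y → List (Vertex d)
initV (stop _)       = []
initV (step x _ w)   = x ∷ initV w

interior : ∀ {d} {x y : Vertex d} → Walk x y → List (Vertex d)
interior (stop _)      = []
interior (step _ _ w)  = initV w

Shortest : ∀ {d} {x y : Vertex d} → Walk x y → Set
Shortest {x = x} {y = y} w = (w' : Walk x y) → len w ≤ len w'

Visible : ∀ {d} → List (Vertex d) → Vertex d → Vertex d → Set
Visible X x y = Σ (Walk x y) λ w → Shortest w × All (λ v → v ∉ X) (interior w)

MutualVisibility : ∀ {d} → List (Vertex d) → Set
MutualVisibility X = ∀ x y → x ∈ X → y ∈ X → Visible X x y

-- π/2 = Σ_{k≥0} 2^k k!² / (2k+1)!  ;  term k = 2^k k!²/(2k+1)!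
-- term 0 = 1, term (k+1) = term k · (k+1)/(2k+3)
halfPiTerm : ℕ → ℚ
halfPiTerm zero    = ℚ.1ℚ
halfPiTerm (suc k) = halfPiTerm k ℚ.* ((+ suc k) / suc (suc (suc (2 * k))))

-- partial sums S N = Σ_{k<N} term k ; strictly increasing with limit π/2
halfPiLower : ℕ → ℚ
halfPiLower zero    = ℚ.0ℚ
halfPiLower (suc n) = halfPiLower n ℚ.+ halfPiTerm n

-- "m > 2^d / sqrt((π/2) d)", i.e. m² · d · (π/2) > 4^d.  Since the S N are
-- lower bounds increasing to π/2 (strictly below it), this holds iff
-- m² · d · S N > 4^d for some N.
AboveBound : ℕ → ℕ → Set
AboveBound d m = ∃ λ N → ((+ (4 ^ d)) / 1) ℚ.< (((+ (m * m * d)) / 1) ℚ.* halfPiLower N)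

{-# OPTIONS --safe #-}
-- The set is the union of the layers a and a + 3 of Q_d (the vertices of weight a and a + 3), where
-- a = ⌊d/2⌋ − 1. Two vertices of the lower layer are joined by a geodesic that first switches off the
-- coordinates to be switched off and then switches on the others, so its interior lies strictly below
-- the layer; complementing all coordinates turns this into a geodesic strictly above the upper layer;
-- and a vertex of weight a is joined to one of weight a + 3 by a geodesic zigzagging between the
-- weights a + 1 and a + 2. For d = 2n or 2n + 1 the absorption identity expresses the size
-- C(d,a) + C(d,a+3) as n(2n+1)/((n+1)(n+2)) times C(2n,n), resp. twice that, so C(2n,n)² ≥ 16ⁿ/(4n)
-- gives |X|²·d > 4^d for d ≥ 13: even the partial sum 1 of the series for π/2 suffices. The remaining
-- dimensions are settled by computation.
module Submission where

open import Defs
open import Data.Nat using (ℕ; _≤_)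
open import Data.List using (List; length)
open import Data.List.Relation.Unary.Unique.Propositional using (Unique)
open import Data.Product using (Σ; _×_)

open import Data.Bool using (Bool; true; false; not; T)
open import Data.Bool.Properties using (not-involutive)
import Data.Bool.Properties as Bool
import Data.Integer as ℤ
import Data.Integer.Properties as ℤ
open import Data.List using ([]; _∷_; map; _++_; head; mapMaybe)
open import Data.List.Properties using (length-map; length-++)
open import Data.List.Membership.Propositional using (_∈_; _∉_)
open import Data.List.Membership.Propositional.Properties using (∈-map⁻; ∈-++⁻)
open import Data.List.Relation.Unary.All using (All)
import Data.List.Relation.Unary.All as All
open import Data.List.Relation.Unary.Any using (here; any?)
import Data.List.Relation.Unary.Unique.Propositional.Properties as Unique
import Data.List.Relation.Unary.Unique.DecPropositional as UniqueDec
open import Data.Maybe using (Maybe; just; nothing; is-just; to-witness-T)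
import Data.Maybe as Maybe
open import Data.Nat
  using (zero; suc; _+_; _*_; _^_; _∸_; _<_; z≤n; s≤s; z<s; s≤s⁻¹; ⌊_/2⌋; _%_; _≡ᵇ_; _≟_;
         NonZero; >-nonZero; >-nonZero⁻¹)
open import Data.Nat.Combinatorics using (_C_; nCk+nC[k+1]≡[n+1]C[k+1]; nCk≡nC[n∸k]; nC1≡n)
open import Data.Nat.Coprimality using (1-coprimeTo)
import Data.Nat.Coprimality as Coprime
open import Data.Nat.Properties
open import Algebra.Properties.CommutativeSemigroup +-commutativeSemigroup using (interchange)
open import Data.Nat.Tactic.RingSolver using (solve; solve-∀)
open import Data.Product using (_,_; Σ-syntax; uncurry)
open import Data.Rational using (mkℚ)
import Data.Rational as ℚ
import Data.Rational.Properties as ℚ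
open import Data.Sum using (inj₁; inj₂)
import Data.Vec as Vec
open import Data.Vec.Properties using (∷-injectiveʳ; ≡-dec)
open import Function using (id)
open import Relation.Binary.Definitions using (DecidableEquality)
open import Relation.Binary.PropositionalEquality
open import Relation.Nullary using (¬_; Dec; yes; no; contradiction; map′; ¬?; _×-dec_)
open import Relation.Nullary.Decidable using (True; toWitness; T?)
open import Relation.Unary using (Decidable)

-- Binomial estimates

pascal : ∀ n k → n C k + n C suc k ≡ suc n C suc k
pascal = nCk+nC[k+1]≡[n+1]C[k+1]

C-sym : ∀ {n} k m → k + m ≡ n → n C k ≡ n C m
C-sym k m refl = trans (nCk≡nC[n∸k] (m≤m+n k m)) (cong ((k + m) C_) (m+n∸m≡n k m))

absorption : ∀ n k → suc k * (n C suc k) + k * (n C k) ≡ n * (n C k)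
absorption zero    zero    = refl
absorption zero    (suc k) = cong₂ _+_ (*-zeroʳ (suc (suc k))) (*-zeroʳ (suc k))
absorption (suc n) zero    = begin
  suc n C 1 + 0 + 0 ≡⟨ cong (λ c → c + 0 + 0) (nC1≡n (suc n)) ⟩
  suc n + 0 + 0     ≡⟨ solve (n ∷ []) ⟩
  suc n * 1         ∎
  where open ≡-Reasoning
absorption (suc n) (suc k) = begin
  suc (suc k) * (suc n C suc (suc k)) + suc k * (suc n C suc k)
    ≡⟨ cong₂ (λ s t → suc (suc k) * s + suc k * t) (sym (pascal n (suc k))) (sym (pascal n k)) ⟩
  suc (suc k) * (n C suc k + n C suc (suc k)) + suc k * (n C k + n C suc k)
    ≡⟨ by-pascal n k (n C k) (n C suc k) (n C suc (suc k)) (absorption n (suc k)) (absorption n k) ⟩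
  suc n * (n C k + n C suc k)
    ≡⟨ cong (suc n *_) (pascal n k) ⟩
  suc n * (suc n C suc k) ∎
  where
  open ≡-Reasoning
  by-pascal : ∀ n k a b c → suc (suc k) * c + suc k * b ≡ n * b → suc k * b + k * a ≡ n * a →
              suc (suc k) * (b + c) + suc k * (a + b) ≡ suc n * (a + b)
  by-pascal n k a b c e₁ e₂ = begin
    suc (suc k) * (b + c) + suc k * (a + b)
      ≡⟨ solve (k ∷ a ∷ b ∷ c ∷ []) ⟩
    (suc (suc k) * c + suc k * b) + (suc k * b + k * a) + (a + b)
      ≡⟨ cong₂ (λ s t → s + t + (a + b)) e₁ e₂ ⟩
    n * b + n * a + (a + b)
      ≡⟨ solve (n ∷ a ∷ b ∷ []) ⟩
    suc n * (a + b) ∎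

absorption′ : ∀ {n} j k → j + k ≡ n → suc k * (n C suc k) ≡ j * (n C k)
absorption′ j k refl =
  +-cancelʳ-≡ (k * ((j + k) C k)) _ _ (trans (absorption (j + k) k) (*-distribʳ-+ ((j + k) C k) j k))

central : ℕ → ℕ
central n = (n + n) C n

central-suc : ∀ n → central (suc n) ≡ (central n + (n + n) C suc n) + (central n + (n + n) C suc n)
central-suc n = begin
  central (suc n)                               ≡⟨ sym (pascal (n + suc n) n) ⟩
  (n + suc n) C n + (n + suc n) C suc n         ≡⟨ cong (_+ (n + suc n) C suc n) (C-sym n (suc n) refl) ⟩
  (n + suc n) C suc n + (n + suc n) C suc n     ≡⟨ cong (λ m → m C suc n + m C suc n) (+-suc n n) ⟩
  suc (n + n) C suc n + suc (n + n) C suc n     ≡⟨ cong (λ c → c + c) (sym (pascal (n + n) n)) ⟩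
  (central n + (n + n) C suc n) + (central n + (n + n) C suc n) ∎
  where open ≡-Reasoning

central-step : ∀ n → suc n * central (suc n) ≡ (2 + 4 * n) * central n
central-step n = trans (cong (suc n *_) (central-suc n)) (collect n (central n) _ (absorption′ n n refl))
  where
  open ≡-Reasoning
  collect : ∀ n b c → suc n * c ≡ n * b → suc n * ((b + c) + (b + c)) ≡ (2 + 4 * n) * b
  collect n b c e = begin
    suc n * ((b + c) + (b + c))     ≡⟨ solve (n ∷ b ∷ c ∷ []) ⟩
    2 * (suc n * b) + 2 * (suc n * c) ≡⟨ cong (λ t → 2 * (suc n * b) + 2 * t) e ⟩
    2 * (suc n * b) + 2 * (n * b)     ≡⟨ solve (n ∷ b ∷ []) ⟩
    (2 + 4 * n) * b                   ∎

central-lower-bound : ∀ p → 4 ^ suc p * 4 ^ suc p ≤ 4 * suc p * (central (suc p) * central (suc p))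
central-lower-bound zero    = ≤-refl
central-lower-bound (suc p) = inductive-step (suc p) (4 ^ suc p) (central (suc p)) (central (suc (suc p)))
                                   (central-step (suc p)) (central-lower-bound p)
  where
  open ≤-Reasoning
  inductive-step : ∀ n x b b′ → suc n * b′ ≡ (2 + 4 * n) * b → x * x ≤ 4 * n * (b * b) →
                   4 * x * (4 * x) ≤ 4 * suc n * (b′ * b′)
  inductive-step n x b b′ e x²≤ = *-cancelˡ-≤ (suc n) (begin
    suc n * (4 * x * (4 * x))                        ≡⟨ solve (n ∷ x ∷ []) ⟩
    16 * suc n * (x * x)                             ≤⟨ *-monoʳ-≤ (16 * suc n) x²≤ ⟩
    16 * suc n * (4 * n * (b * b))                   ≤⟨ m≤m+n _ (16 * (b * b)) ⟩
    16 * suc n * (4 * n * (b * b)) + 16 * (b * b)    ≡⟨ solve (n ∷ b ∷ []) ⟩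
    4 * ((2 + 4 * n) * b) * ((2 + 4 * n) * b)        ≡⟨ cong (λ t → 4 * t * t) (sym e) ⟩
    4 * (suc n * b′) * (suc n * b′)                  ≡⟨ solve (n ∷ b′ ∷ []) ⟩
    suc n * (4 * suc n * (b′ * b′))                  ∎)

central²-nonZero : ∀ p → NonZero (central (suc p) * central (suc p))
central²-nonZero p = m*n≢0⇒n≢0 (4 * suc p) {{>-nonZero (<-≤-trans 0<x² (central-lower-bound p))}}
  where
  0<x² : 0 < 4 ^ suc p * 4 ^ suc p
  0<x² = >-nonZero⁻¹ _ {{m*n≢0 _ _ {{m^n≢0 4 (suc p)}} {{m^n≢0 4 (suc p)}}}}

middle : ℕ → ℕ
middle n = (n + n) C suc n + (n + n) C (2 + n)

middle-ratio : ∀ p → (2 + p) * (3 + p) * middle (suc p) ≡ suc p * (3 + 2 * p) * central (suc p)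
middle-ratio p =
  ratio p (central (suc p)) _ _ (absorption′ (suc p) (suc p) refl) (absorption′ p (2 + p) (+-suc p (suc p)))
  where
  open ≡-Reasoning
  ratio : ∀ p b c₁ c₂ → (2 + p) * c₁ ≡ suc p * b → (3 + p) * c₂ ≡ p * c₁ →
          (2 + p) * (3 + p) * (c₁ + c₂) ≡ suc p * (3 + 2 * p) * b
  ratio p b c₁ c₂ e₁ e₂ = begin
    (2 + p) * (3 + p) * (c₁ + c₂)                       ≡⟨ solve (p ∷ c₁ ∷ c₂ ∷ []) ⟩
    (3 + p) * ((2 + p) * c₁) + (2 + p) * ((3 + p) * c₂) ≡⟨ cong₂ (λ s t → (3 + p) * s + (2 + p) * t) e₁ e₂ ⟩
    (3 + p) * (suc p * b) + (2 + p) * (p * c₁)          ≡⟨ solve (p ∷ b ∷ c₁ ∷ []) ⟩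
    (3 + p) * (suc p * b) + p * ((2 + p) * c₁)          ≡⟨ cong (λ t → (3 + p) * (suc p * b) + p * t) e₁ ⟩
    (3 + p) * (suc p * b) + p * (suc p * b)             ≡⟨ solve (p ∷ b ∷ []) ⟩
    suc p * (3 + 2 * p) * b                             ∎

transfer-bound : ∀ {n x b k m s f} .{{_ : NonZero n}} .{{_ : NonZero (b * b)}} →
                 x * x ≤ 4 * n * (b * b) → k * m ≡ n * s * b → 4 * (k * k) < n * (s * s) * f →
                 x * x < m * m * f
transfer-bound {n} {x} {b} {k} {m} {s} {f} x²≤ km≡nsb margin =
  *-cancelˡ-< (k * k) (x * x) (m * m * f) (begin-strict
    k * k * (x * x)                 ≤⟨ *-monoʳ-≤ (k * k) x²≤ ⟩
    k * k * (4 * n * (b * b))       ≡⟨ solve (k ∷ n ∷ b ∷ []) ⟩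
    n * (4 * (k * k)) * (b * b)     <⟨ *-monoˡ-< (b * b) (*-monoʳ-< n margin) ⟩
    n * (n * (s * s) * f) * (b * b) ≡⟨ solve (n ∷ s ∷ f ∷ b ∷ []) ⟩
    (n * s * b) * (n * s * b) * f   ≡⟨ cong (λ t → t * t * f) (sym km≡nsb) ⟩
    (k * m) * (k * m) * f           ≡⟨ solve (k ∷ m ∷ f ∷ []) ⟩
    k * k * (m * m * f)             ∎)
  where open ≤-Reasoning

middle-bound : ∀ p f →
  4 * ((2 + p) * (3 + p) * ((2 + p) * (3 + p))) < suc p * ((3 + 2 * p) * (3 + 2 * p)) * f →
  4 ^ suc p * 4 ^ suc p < middle (suc p) * middle (suc p) * f
middle-bound p f =
  transfer-bound {suc p} {4 ^ suc p} {central (suc p)} {(2 + p) * (3 + p)} {middle (suc p)} {3 + 2 * p} {f}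
                 {{_}} {{central²-nonZero p}} (central-lower-bound p) (middle-ratio p)

gap⇒< : ∀ {m n} k → m + suc k ≡ n → m < n
gap⇒< {m} k eq = subst (m <_) eq (m<m+n m z<s)

-- The slack in each margin, expanded in t, is a polynomial with positive coefficients.
even-margin : ∀ p → 6 ≤ p →
  4 * ((2 + p) * (3 + p) * ((2 + p) * (3 + p))) < suc p * ((3 + 2 * p) * (3 + 2 * p)) * (suc p + suc p)
even-margin p 6≤p with m≤n⇒∃[o]m+o≡n 6≤p
... | t , refl = gap⇒< _ (expand t)
  where
  expand : ∀ t → let p = 6 + t in
    4 * ((2 + p) * (3 + p) * ((2 + p) * (3 + p)))
      + suc (1313 + 2388 * t + 790 * (t * t) + 96 * (t * t * t) + 4 * (t * t * t * t))
    ≡ suc p * ((3 + 2 * p) * (3 + 2 * p)) * (suc p + suc p)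
  expand = solve-∀

odd-margin : ∀ p → 5 ≤ p →
  4 * ((2 + p) * (3 + p) * ((2 + p) * (3 + p))) < suc p * ((3 + 2 * p) * (3 + 2 * p)) * suc (suc p + suc p)
odd-margin p 5≤p with m≤n⇒∃[o]m+o≡n 5≤p
... | t , refl = gap⇒< _ (expand t)
  where
  expand : ∀ t → let p = 5 + t in
    4 * ((2 + p) * (3 + p) * ((2 + p) * (3 + p)))
      + suc (637 + 1561 * t + 602 * (t * t) + 84 * (t * t * t) + 4 * (t * t * t * t))
    ≡ suc p * ((3 + 2 * p) * (3 + 2 * p)) * suc (suc p + suc p)
  expand = solve-∀

middle-even : ∀ p → 6 ≤ p → 4 ^ (suc p + suc p) < middle (suc p) * middle (suc p) * (suc p + suc p)
middle-even p 6≤p = begin-strict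
  4 ^ (suc p + suc p)         ≡⟨ ^-distribˡ-+-* 4 (suc p) (suc p) ⟩
  4 ^ suc p * 4 ^ suc p       <⟨ middle-bound p (suc p + suc p) (even-margin p 6≤p) ⟩
  middle (suc p) * middle (suc p) * (suc p + suc p) ∎
  where open ≤-Reasoning

middle-odd : ∀ p → 5 ≤ p →
  4 ^ suc (suc p + suc p) <
  (middle (suc p) + middle (suc p)) * (middle (suc p) + middle (suc p)) * suc (suc p + suc p)
middle-odd p 5≤p = begin-strict
  4 * 4 ^ (suc p + suc p)                   ≡⟨ cong (4 *_) (^-distribˡ-+-* 4 (suc p) (suc p)) ⟩
  4 * (4 ^ suc p * 4 ^ suc p)               <⟨ *-monoʳ-< 4 (middle-bound p f (odd-margin p 5≤p)) ⟩
  4 * (middle (suc p) * middle (suc p) * f) ≡⟨ quadruple (middle (suc p)) f ⟩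
  (middle (suc p) + middle (suc p)) * (middle (suc p) + middle (suc p)) * f ∎
  where
  open ≤-Reasoning
  f : ℕ
  f = suc (suc p + suc p)
  quadruple : ∀ a s → 4 * (a * a * s) ≡ (a + a) * (a + a) * s
  quadruple a s = solve (a ∷ s ∷ [])

-- Geodesics in the hypercube

-- Imported only here: their constructors _∷_ would make the variable lists passed to solve above ambiguous.
open import Data.Vec using (Vec; []; _∷_)
open import Data.List.Relation.Unary.All using ([]; _∷_)
open import Data.List.Relation.Unary.AllPairs using ([]; _∷_)

differ-triangle : ∀ a b c → differ a c ≤ differ a b + differ b c
differ-triangle true  true  _     = ≤-refl
differ-triangle false false _     = ≤-refl
differ-triangle true  false true  = z≤n
differ-triangle true  false false = s≤s z≤n
differ-triangle false true  true  = s≤s z≤n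
differ-triangle false true  false = z≤n

hamming-refl : ∀ {d} (x : Vertex d) → hamming x x ≡ 0
hamming-refl []          = refl
hamming-refl (true ∷ x)  = hamming-refl x
hamming-refl (false ∷ x) = hamming-refl x

hamming-triangle : ∀ {d} (x y z : Vertex d) → hamming x z ≤ hamming x y + hamming y z
hamming-triangle []      []      []      = z≤n
hamming-triangle (a ∷ x) (b ∷ y) (c ∷ z) = begin
  differ a c + hamming x z
    ≤⟨ +-mono-≤ (differ-triangle a b c) (hamming-triangle x y z) ⟩
  (differ a b + differ b c) + (hamming x y + hamming y z)
    ≡⟨ interchange (differ a b) (differ b c) (hamming x y) (hamming y z) ⟩
  (differ a b + hamming x y) + (differ b c + hamming y z) ∎
  where open ≤-Reasoning

hamming≤len : ∀ {d} {x y : Vertex d} (w : Walk x y) → hamming x y ≤ len w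
hamming≤len (stop x)                = ≤-reflexive (hamming-refl x)
hamming≤len (step x {y} {z} adj w) = begin
  hamming x z               ≤⟨ hamming-triangle x y z ⟩
  hamming x y + hamming y z ≡⟨ cong (_+ hamming y z) adj ⟩
  suc (hamming y z)         ≤⟨ s≤s (hamming≤len w) ⟩
  suc (len w)               ∎
  where open ≤-Reasoning

len≡hamming⇒shortest : ∀ {d} {x y : Vertex d} (w : Walk x y) → len w ≡ hamming x y → Shortest w
len≡hamming⇒shortest w eq w′ = subst (_≤ len w′) (sym eq) (hamming≤len w′)

weight : ∀ {d} → Vertex d → ℕ
weight []          = 0
weight (true ∷ x)  = suc (weight x)
weight (false ∷ x) = weight x

drops rises : ∀ {d} → Vertex d → Vertex d → ℕ
drops []          []           = 0
drops (true ∷ x)  (false ∷ y)  = suc (drops x y)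
drops (_ ∷ x)     (_ ∷ y)      = drops x y
rises []          []           = 0
rises (false ∷ x) (true ∷ y)   = suc (rises x y)
rises (_ ∷ x)     (_ ∷ y)      = rises x y

weight+rises≡weight+drops : ∀ {d} (x y : Vertex d) → weight x + rises x y ≡ weight y + drops x y
weight+rises≡weight+drops []          []          = refl
weight+rises≡weight+drops (true ∷ x)  (true ∷ y)  = cong suc (weight+rises≡weight+drops x y)
weight+rises≡weight+drops (true ∷ x)  (false ∷ y) =
  trans (cong suc (weight+rises≡weight+drops x y)) (sym (+-suc _ _))
weight+rises≡weight+drops (false ∷ x) (true ∷ y)  =
  trans (+-suc _ _) (cong suc (weight+rises≡weight+drops x y))
weight+rises≡weight+drops (false ∷ x) (false ∷ y) = weight+rises≡weight+drops x y

rises≡gap+drops : ∀ {d i} (x y : Vertex d) → weight y ≡ i + weight x → rises x y ≡ i + drops x y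
rises≡gap+drops {i = i} x y eq = +-cancelˡ-≡ (weight x) _ _ (begin
  weight x + rises x y       ≡⟨ weight+rises≡weight+drops x y ⟩
  weight y + drops x y       ≡⟨ cong (_+ drops x y) eq ⟩
  (i + weight x) + drops x y ≡⟨ cong (_+ drops x y) (+-comm i (weight x)) ⟩
  (weight x + i) + drops x y ≡⟨ +-assoc (weight x) i (drops x y) ⟩
  weight x + (i + drops x y) ∎)
  where open ≡-Reasoning

no-drops⇒weight≡rises+weight : ∀ {d n} (x y : Vertex d) → drops x y ≡ 0 → rises x y ≡ n →
                               weight y ≡ n + weight x
no-drops⇒weight≡rises+weight x y d₀ refl = begin
  weight y                 ≡⟨ sym (+-identityʳ (weight y)) ⟩
  weight y + 0             ≡⟨ cong (weight y +_) (sym d₀) ⟩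
  weight y + drops x y     ≡⟨ sym (weight+rises≡weight+drops x y) ⟩
  weight x + rises x y     ≡⟨ +-comm (weight x) (rises x y) ⟩
  rises x y + weight x     ∎
  where open ≡-Reasoning

no-drops-no-rises⇒≡ : ∀ {d} (x y : Vertex d) → drops x y ≡ 0 → rises x y ≡ 0 → x ≡ y
no-drops-no-rises⇒≡ []          []          _  _  = refl
no-drops-no-rises⇒≡ (true ∷ x)  (true ∷ y)  d₀ r₀ = cong (true ∷_)  (no-drops-no-rises⇒≡ x y d₀ r₀)
no-drops-no-rises⇒≡ (false ∷ x) (false ∷ y) d₀ r₀ = cong (false ∷_) (no-drops-no-rises⇒≡ x y d₀ r₀)

record Closer {d} (y x x′ : Vertex d) : Set where
  constructor closer
  field
    adjacent : Adj x x′
    nearer   : hamming x y ≡ suc (hamming x′ y)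

∷-closer : ∀ {d} a b {x y x′ : Vertex d} → Closer y x x′ → Closer (b ∷ y) (a ∷ x) (a ∷ x′)
∷-closer true  b (closer adj nearer) = closer adj (trans (cong (differ true b +_) nearer) (+-suc _ _))
∷-closer false b (closer adj nearer) = closer adj (trans (cong (differ false b +_) nearer) (+-suc _ _))

descend : ∀ {d n} (x y : Vertex d) → drops x y ≡ suc n →
          Σ[ x′ ∈ Vertex d ] Closer y x x′ × drops x′ y ≡ n × rises x′ y ≡ rises x y
                             × weight x ≡ suc (weight x′)
descend []          []          ()
descend (true ∷ x) (false ∷ y) eq =
  false ∷ x , closer (cong suc (hamming-refl x)) refl , suc-injective eq , refl , refl
descend (true ∷ x) (true ∷ y) eq with descend x y eq
... | x′ , c , d′ , r′ , w = true ∷ x′ , ∷-closer true true c , d′ , r′ , cong suc w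
descend (false ∷ x) (true ∷ y) eq with descend x y eq
... | x′ , c , d′ , r′ , w = false ∷ x′ , ∷-closer false true c , d′ , cong suc r′ , w
descend (false ∷ x) (false ∷ y) eq with descend x y eq
... | x′ , c , d′ , r′ , w = false ∷ x′ , ∷-closer false false c , d′ , r′ , w

ascend : ∀ {d n} (x y : Vertex d) → rises x y ≡ suc n →
         Σ[ x′ ∈ Vertex d ] Closer y x x′ × rises x′ y ≡ n × drops x′ y ≡ drops x y
                            × weight x′ ≡ suc (weight x)
ascend []          []          ()
ascend (false ∷ x) (true ∷ y) eq =
  true ∷ x , closer (cong suc (hamming-refl x)) refl , suc-injective eq , refl , refl
ascend (false ∷ x) (false ∷ y) eq with ascend x y eq
... | x′ , c , r′ , d′ , w = false ∷ x′ , ∷-closer false false c , r′ , d′ , w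
ascend (true ∷ x) (false ∷ y) eq with ascend x y eq
... | x′ , c , r′ , d′ , w = true ∷ x′ , ∷-closer true false c , r′ , cong suc d′ , cong suc w
ascend (true ∷ x) (true ∷ y) eq with ascend x y eq
... | x′ , c , r′ , d′ , w = true ∷ x′ , ∷-closer true true c , r′ , d′ , cong suc w

record Route {d} (P : Vertex d → Set) (x y : Vertex d) : Set where
  constructor route
  field
    walk        : Walk x y
    len≡hamming : len walk ≡ hamming x y
    inside      : All P (initV walk)

record Geodesic {d} (P : Vertex d → Set) (x y : Vertex d) : Set where
  constructor geodesic
  field
    walk        : Walk x y
    len≡hamming : len walk ≡ hamming x y
    inside      : All P (interior walk)

arrived : ∀ {d P} (x : Vertex d) → Route P x x
arrived x = route (stop x) (sym (hamming-refl x)) []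

stationary : ∀ {d P} (x : Vertex d) → Geodesic P x x
stationary x = geodesic (stop x) (sym (hamming-refl x)) []

prepend : ∀ {d P} {x x′ y : Vertex d} → P x → Closer y x x′ → Route P x′ y → Route P x y
prepend px (closer adj nearer) (route w l pw) = route (step _ adj w) (trans (cong suc l) (sym nearer)) (px ∷ pw)

depart : ∀ {d P} {x x′ y : Vertex d} → Closer y x x′ → Route P x′ y → Geodesic P x y
depart (closer adj nearer) (route w l pw) = geodesic (step _ adj w) (trans (cong suc l) (sym nearer)) pw

visible : ∀ {d P} {X : List (Vertex d)} {x y : Vertex d} →
          Geodesic P x y → (∀ {v} → P v → v ∉ X) → Visible X x y
visible (geodesic w l pw) avoid = w , len≡hamming⇒shortest w l , All.map avoid pw

WeightBetween : ∀ {d} → ℕ → ℕ → Vertex d → Set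
WeightBetween a b v = a < weight v × weight v < b

ascent : ∀ {d} n (x y : Vertex d) → rises x y ≡ n → drops x y ≡ 0 →
         Route (λ v → weight v < weight y) x y
ascent zero    x y r₀ d₀ with no-drops-no-rises⇒≡ x y d₀ r₀
... | refl = arrived x
ascent (suc n) x y r  d₀ with ascend x y r
... | x′ , c , r′ , d′ , _ = prepend x<y c (ascent n x′ y r′ (trans d′ d₀))
  where
  x<y : weight x < weight y
  x<y = subst (weight x <_) (sym (no-drops⇒weight≡rises+weight x y d₀ r)) (m<n+m (weight x) z<s)

descent-ascent : ∀ {d} n (x y : Vertex d) → drops x y ≡ n → weight x < weight y →
                 Route (λ v → weight v < weight y) x y
descent-ascent zero    x y d₀ _   = ascent (rises x y) x y refl d₀
descent-ascent (suc n) x y dr x<y with descend x y dr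
... | x′ , c , d′ , _ , w = prepend x<y c (descent-ascent n x′ y d′ (<-trans (≤-reflexive (sym w)) x<y))

valley : ∀ {d k} (x y : Vertex d) → weight x ≡ k → weight y ≡ k → Geodesic (λ v → weight v < k) x y
valley x y wx refl with drops x y in dr
... | zero with no-drops-no-rises⇒≡ x y dr (trans (rises≡gap+drops {i = 0} x y (sym wx)) dr)
...   | refl = stationary x
valley x y wx refl | suc n with descend x y dr
...   | x′ , c , d′ , _ , w =
  depart c (descent-ascent n x′ y d′ (subst (weight x′ <_) wx (≤-reflexive (sym w))))

band-lower : ∀ {d a} (v : Vertex d) → weight v ≡ 1 + a → WeightBetween a (3 + a) v
band-lower {a = a} _ w rewrite w = n<1+n a , s≤s (s≤s (n≤1+n a))

band-upper : ∀ {d a} (v : Vertex d) → weight v ≡ 2 + a → WeightBetween a (3 + a) v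
band-upper {a = a} _ w rewrite w = m<n+m a z<s , n<1+n (2 + a)

zigzag : ∀ {d a} n (x y : Vertex d) → drops x y ≡ n → rises x y ≡ suc n → weight x ≡ 2 + a →
         Route (WeightBetween a (3 + a)) x y
zigzag zero    x y d₀ r₁ wx with ascend x y r₁
... | x′ , c , r₀ , d′ , _ with no-drops-no-rises⇒≡ x′ y (trans d′ d₀) r₀
...   | refl = prepend (band-upper x wx) c (arrived y)
zigzag {a = a} (suc n) x y dr r wx with descend x y dr
... | x₁ , c₁ , d₁ , r₁ , w₁ with ascend x₁ y (trans r₁ r)
...   | x₂ , c₂ , r₂ , d₂ , w₂ =
  prepend (band-upper x wx) c₁ (prepend (band-lower x₁ wx₁) c₂
    (zigzag n x₂ y (trans d₂ d₁) r₂ (trans w₂ (cong suc wx₁))))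
  where
  wx₁ : weight x₁ ≡ 1 + a
  wx₁ = suc-injective (trans (sym w₁) wx)

crossing : ∀ {d a} (x y : Vertex d) → weight x ≡ a → weight y ≡ 3 + a →
           Geodesic (WeightBetween a (3 + a)) x y
crossing x y refl wy with ascend x y (rises≡gap+drops x y wy)
... | x₁ , c₁ , r₁ , d₁ , w₁ with ascend x₁ y r₁
...   | x₂ , c₂ , r₂ , d₂ , w₂ =
  depart c₁ (prepend (band-lower x₁ w₁) c₂
    (zigzag (drops x y) x₂ y (trans d₂ d₁) r₂ (trans w₂ (cong suc w₁))))

complement : ∀ {d} → Vertex d → Vertex d
complement = Vec.map not

complement-involutive : ∀ {d} (x : Vertex d) → complement (complement x) ≡ x
complement-involutive []      = refl
complement-involutive (a ∷ x) = cong₂ _∷_ (not-involutive a) (complement-involutive x)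

hamming-complement : ∀ {d} (x y : Vertex d) → hamming (complement x) (complement y) ≡ hamming x y
hamming-complement []          []          = refl
hamming-complement (true ∷ x)  (true ∷ y)  = hamming-complement x y
hamming-complement (true ∷ x)  (false ∷ y) = cong suc (hamming-complement x y)
hamming-complement (false ∷ x) (true ∷ y)  = cong suc (hamming-complement x y)
hamming-complement (false ∷ x) (false ∷ y) = hamming-complement x y

weight+weight-complement : ∀ {d} (x : Vertex d) → weight x + weight (complement x) ≡ d
weight+weight-complement []          = refl
weight+weight-complement (true ∷ x)  = cong suc (weight+weight-complement x)
weight+weight-complement (false ∷ x) = trans (+-suc _ _) (cong suc (weight+weight-complement x))

+-exchange-< : ∀ {m n o p} → m + n ≡ o + p → o < n → m < p
+-exchange-< {m} {n} {o} {p} eq o<n = +-cancelʳ-< n m p (begin-strict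
  m + n ≡⟨ eq ⟩
  o + p <⟨ +-monoˡ-< p o<n ⟩
  n + p ≡⟨ +-comm n p ⟩
  p + n ∎)
  where open ≤-Reasoning

complement-swap-< : ∀ {d} (u v : Vertex d) →
                    weight u < weight (complement v) → weight v < weight (complement u)
complement-swap-< u v = +-exchange-< (trans (weight+weight-complement v) (sym (weight+weight-complement u)))

complement-swap-<′ : ∀ {d} (u v : Vertex d) →
                     weight (complement u) < weight v → weight (complement v) < weight u
complement-swap-<′ u v = +-exchange-< (begin
  weight (complement v) + weight v ≡⟨ +-comm (weight (complement v)) (weight v) ⟩
  weight v + weight (complement v) ≡⟨ weight+weight-complement v ⟩
  _                                ≡⟨ sym (weight+weight-complement u) ⟩
  weight u + weight (complement u) ≡⟨ +-comm (weight u) (weight (complement u)) ⟩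
  weight (complement u) + weight u ∎)
  where open ≡-Reasoning

complement-shift : ∀ {d i} (x y : Vertex d) → weight y ≡ i + weight x →
                   weight (complement x) ≡ i + weight (complement y)
complement-shift {i = i} x y eq = +-cancelˡ-≡ (weight x) _ _ (begin
  weight x + weight (complement x)       ≡⟨ weight+weight-complement x ⟩
  _                                      ≡⟨ sym (weight+weight-complement y) ⟩
  weight y + weight (complement y)       ≡⟨ cong (_+ weight (complement y)) (trans eq (+-comm i (weight x))) ⟩
  weight x + i + weight (complement y)   ≡⟨ +-assoc (weight x) i (weight (complement y)) ⟩
  weight x + (i + weight (complement y)) ∎)
  where open ≡-Reasoning

complementWalk : ∀ {d} {x y : Vertex d} → Walk x y → Walk (complement x) (complement y)
complementWalk (stop x)           = stop (complement x)
complementWalk (step x {y} adj w) = step (complement x) (trans (hamming-complement x y) adj) (complementWalk w)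

len-complementWalk : ∀ {d} {x y : Vertex d} (w : Walk x y) → len (complementWalk w) ≡ len w
len-complementWalk (stop _)       = refl
len-complementWalk (step _ _ w)   = cong suc (len-complementWalk w)

initV-complementWalk : ∀ {d} {P Q : Vertex d → Set} → (∀ {u} → P u → Q (complement u)) →
                       ∀ {x y} (w : Walk x y) → All P (initV w) → All Q (initV (complementWalk w))
initV-complementWalk f (stop _)     []       = []
initV-complementWalk f (step _ _ w) (p ∷ ps) = f p ∷ initV-complementWalk f w ps

by-complement : ∀ {d} {P Q : Vertex d → Set} {x y} → (∀ {u} → P u → Q (complement u)) →
                Geodesic P (complement x) (complement y) → Geodesic Q x y
by-complement {P = P} {Q} {x} {y} f (geodesic w l pw) =
  subst₂ (Geodesic _) (complement-involutive x) (complement-involutive y)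
    (geodesic (complementWalk w) (trans (len-complementWalk w) (trans l (sym (hamming-complement x̄ ȳ))))
              (interior-map w pw))
  where
  x̄ ȳ : Vertex _
  x̄ = complement x
  ȳ = complement y
  interior-map : ∀ {s t} (w : Walk s t) → All P (interior w) → All Q (interior (complementWalk w))
  interior-map (stop _)     []  = []
  interior-map (step _ _ w) pw  = initV-complementWalk f w pw

hill : ∀ {d k} (x y : Vertex d) → weight x ≡ k → weight y ≡ k → Geodesic (λ v → k < weight v) x y
hill x y refl wy = by-complement (λ {u} → complement-swap-< u x)
  (valley (complement x) (complement y) refl (sym (complement-shift {i = 0} x y wy)))

crossing-down : ∀ {d a} (x y : Vertex d) → weight x ≡ 3 + a → weight y ≡ a →
                Geodesic (WeightBetween a (3 + a)) x y
crossing-down x y wx refl =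
  by-complement (λ {u} → between {u}) (crossing (complement x) (complement y) refl ȳ≡3+x̄)
  where
  ȳ≡3+x̄ : weight (complement y) ≡ 3 + weight (complement x)
  ȳ≡3+x̄ = complement-shift y x wx
  between : ∀ {u} → WeightBetween (weight (complement x)) (3 + weight (complement x)) u →
            WeightBetween (weight y) (3 + weight y) (complement u)
  between {u} (x̄<u , u<3+x̄) =
    complement-swap-< u y (subst (weight u <_) (sym ȳ≡3+x̄) u<3+x̄) ,
    subst (weight (complement u) <_) wx (complement-swap-<′ x u x̄<u)

-- Two layers at distance three

layer : (d k : ℕ) → List (Vertex d)
layer zero    zero    = [] ∷ []
layer zero    (suc k) = []
layer (suc d) zero    = map (false ∷_) (layer d zero)
layer (suc d) (suc k) = map (true ∷_) (layer d k) ++ map (false ∷_) (layer d (suc k))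

length-layer : ∀ d k → length (layer d k) ≡ d C k
length-layer zero    zero    = refl
length-layer zero    (suc k) = refl
length-layer (suc d) zero    = trans (length-map (false ∷_) (layer d zero)) (length-layer d zero)
length-layer (suc d) (suc k) = begin
  length (map (true ∷_) (layer d k) ++ map (false ∷_) (layer d (suc k)))
    ≡⟨ length-++ (map (true ∷_) (layer d k)) ⟩
  length (map (true ∷_) (layer d k)) + length (map (false ∷_) (layer d (suc k)))
    ≡⟨ cong₂ _+_ (length-map (true ∷_) (layer d k)) (length-map (false ∷_) (layer d (suc k))) ⟩
  length (layer d k) + length (layer d (suc k))
    ≡⟨ cong₂ _+_ (length-layer d k) (length-layer d (suc k)) ⟩
  d C k + d C suc k
    ≡⟨ pascal d k ⟩
  suc d C suc k ∎
  where open ≡-Reasoning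

∈-layer⇒weight : ∀ d k {v} → v ∈ layer d k → weight v ≡ k
∈-layer⇒weight zero    zero    (here refl) = refl
∈-layer⇒weight (suc d) zero    v∈ with ∈-map⁻ (false ∷_) v∈
... | _ , u∈ , refl = ∈-layer⇒weight d zero u∈
∈-layer⇒weight (suc d) (suc k) v∈ with ∈-++⁻ (map (true ∷_) (layer d k)) v∈
... | inj₁ v∈₁ with ∈-map⁻ (true ∷_) v∈₁
...   | _ , u∈ , refl = cong suc (∈-layer⇒weight d k u∈)
∈-layer⇒weight (suc d) (suc k) v∈ | inj₂ v∈₂ with ∈-map⁻ (false ∷_) v∈₂
...   | _ , u∈ , refl = ∈-layer⇒weight d (suc k) u∈

layer-unique : ∀ d k → Unique (layer d k)
layer-unique zero    zero    = [] ∷ []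
layer-unique zero    (suc k) = []
layer-unique (suc d) zero    = Unique.map⁺ ∷-injectiveʳ (layer-unique d zero)
layer-unique (suc d) (suc k) =
  Unique.++⁺ (Unique.map⁺ ∷-injectiveʳ (layer-unique d k)) (Unique.map⁺ ∷-injectiveʳ (layer-unique d (suc k)))
             disjoint
  where
  disjoint : ∀ {v} → ¬ (v ∈ map (true ∷_) (layer d k) × v ∈ map (false ∷_) (layer d (suc k)))
  disjoint (v∈₁ , v∈₂) with ∈-map⁻ (true ∷_) v∈₁ | ∈-map⁻ (false ∷_) v∈₂
  ... | _ , _ , refl | _ , _ , ()

twoLayers : (d a : ℕ) → List (Vertex d)
twoLayers d a = layer d a ++ layer d (3 + a)

length-twoLayers : ∀ d a → length (twoLayers d a) ≡ d C a + d C (3 + a)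
length-twoLayers d a = trans (length-++ (layer d a)) (cong₂ _+_ (length-layer d a) (length-layer d (3 + a)))

twoLayers-unique : ∀ d a → Unique (twoLayers d a)
twoLayers-unique d a = Unique.++⁺ (layer-unique d a) (layer-unique d (3 + a)) λ (v∈₁ , v∈₂) →
  <⇒≢ (m<n+m a z<s) (trans (sym (∈-layer⇒weight d a v∈₁)) (∈-layer⇒weight d (3 + a) v∈₂))

∉-twoLayers : ∀ d a {v} → weight v ≢ a → weight v ≢ 3 + a → v ∉ twoLayers d a
∉-twoLayers d a w≢a w≢3+a v∈ with ∈-++⁻ (layer d a) v∈
... | inj₁ v∈₁ = w≢a (∈-layer⇒weight d a v∈₁)
... | inj₂ v∈₂ = w≢3+a (∈-layer⇒weight d (3 + a) v∈₂)

module _ (d a : ℕ) where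

  private
    below : ∀ {v} → weight v < a → v ∉ twoLayers d a
    below w<a = ∉-twoLayers d a (<⇒≢ w<a) (<⇒≢ (<-trans w<a (m<n+m a z<s)))

    above : ∀ {v} → 3 + a < weight v → v ∉ twoLayers d a
    above 3+a<w = ∉-twoLayers d a (>⇒≢ (<-trans (m<n+m a z<s) 3+a<w)) (>⇒≢ 3+a<w)

    between : ∀ {v} → WeightBetween a (3 + a) v → v ∉ twoLayers d a
    between (a<w , w<3+a) = ∉-twoLayers d a (>⇒≢ a<w) (<⇒≢ w<3+a)

    lower : ∀ {v} → v ∈ layer d a → weight v ≡ a
    lower = ∈-layer⇒weight d a

    upper : ∀ {v} → v ∈ layer d (3 + a) → weight v ≡ 3 + a
    upper = ∈-layer⇒weight d (3 + a)

  twoLayers-mutualVisibility : MutualVisibility (twoLayers d a)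
  twoLayers-mutualVisibility x y x∈ y∈ with ∈-++⁻ (layer d a) x∈ | ∈-++⁻ (layer d a) y∈
  ... | inj₁ x∈ₗ | inj₁ y∈ₗ = visible (valley x y (lower x∈ₗ) (lower y∈ₗ)) below
  ... | inj₂ x∈ᵤ | inj₂ y∈ᵤ = visible (hill x y (upper x∈ᵤ) (upper y∈ᵤ)) above
  ... | inj₁ x∈ₗ | inj₂ y∈ᵤ = visible (crossing x y (lower x∈ₗ) (upper y∈ᵤ)) between
  ... | inj₂ x∈ᵤ | inj₁ y∈ₗ = visible (crossing-down x y (upper x∈ᵤ) (lower y∈ₗ)) between

twoLayers-size-even : ∀ p → length (twoLayers (suc p + suc p) p) ≡ middle (suc p)
twoLayers-size-even p =
  trans (length-twoLayers _ p) (cong (_+ (suc p + suc p) C (3 + p)) (C-sym p (2 + p) (+-suc p (suc p))))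

twoLayers-size-odd : ∀ p → length (twoLayers (suc (suc p + suc p)) p) ≡ middle (suc p) + middle (suc p)
twoLayers-size-odd p = begin
  length (twoLayers D p)          ≡⟨ length-twoLayers D p ⟩
  D C p + D C (3 + p)             ≡⟨ cong (_+ D C (3 + p)) (C-sym p (3 + p) p+[3+p]≡D) ⟩
  D C (3 + p) + D C (3 + p)       ≡⟨ cong (λ c → c + c) (sym (pascal (suc p + suc p) (2 + p))) ⟩
  middle (suc p) + middle (suc p) ∎
  where
  open ≡-Reasoning
  D : ℕ
  D = suc (suc p + suc p)
  p+[3+p]≡D : p + (3 + p) ≡ D
  p+[3+p]≡D = trans (+-suc p (2 + p)) (cong suc (+-suc p (suc p)))

middleLayers : (d : ℕ) → List (Vertex d)
middleLayers d = twoLayers d (⌊ d /2⌋ ∸ 1)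

data EvenOrOdd : ℕ → Set where
  even : ∀ n → EvenOrOdd (n + n)
  odd  : ∀ n → EvenOrOdd (suc (n + n))

evenOrOdd : ∀ d → EvenOrOdd d
evenOrOdd zero = even zero
evenOrOdd (suc d) with evenOrOdd d
... | even n = odd n
... | odd n  = subst EvenOrOdd (cong suc (+-suc n n)) (even (suc n))

⌊1+n+n/2⌋≡n : ∀ n → ⌊ suc (n + n) /2⌋ ≡ n
⌊1+n+n/2⌋≡n zero    = refl
⌊1+n+n/2⌋≡n (suc n) = cong suc (trans (cong ⌊_/2⌋ (+-suc n n)) (⌊1+n+n/2⌋≡n n))

m+m<n+n⇒m<n : ∀ {m n} → m + m < n + n → m < n
m+m<n+n⇒m<n {m} {n} lt with m <? n
... | yes m<n = m<n
... | no  m≮n = contradiction lt (≤⇒≯ (+-mono-≤ (≮⇒≥ m≮n) (≮⇒≥ m≮n)))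

middleLayers-large : ∀ d → 13 ≤ d → 4 ^ d < length (middleLayers d) * length (middleLayers d) * d
middleLayers-large d 13≤d with evenOrOdd d
middleLayers-large .(suc p + suc p) 13≤d | even (suc p) =
  subst (λ m → 4 ^ (suc p + suc p) < m * m * (suc p + suc p)) (sym size)
        (middle-even p (s≤s⁻¹ (m+m<n+n⇒m<n {6} 13≤d)))
  where
  size : length (middleLayers (suc p + suc p)) ≡ middle (suc p)
  size = trans (cong (λ h → length (twoLayers (suc p + suc p) (h ∸ 1))) (sym (n≡⌊n+n/2⌋ (suc p))))
               (twoLayers-size-even p)
middleLayers-large .1 (s≤s ()) | odd zero
middleLayers-large .(suc (suc p + suc p)) 13≤d | odd (suc p) =
  subst (λ m → 4 ^ suc (suc p + suc p) < m * m * suc (suc p + suc p)) (sym size)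
        (middle-odd p (s≤s⁻¹ (m+m<n+n⇒m<n {5} (≤-trans (n≤1+n 11) (s≤s⁻¹ 13≤d)))))
  where
  size : length (middleLayers (suc (suc p + suc p))) ≡ middle (suc p) + middle (suc p)
  size = trans (cong (λ h → length (twoLayers (suc (suc p + suc p)) (h ∸ 1))) (⌊1+n+n/2⌋≡n (suc p)))
               (twoLayers-size-odd p)

-- The bound, and small dimensions by computation

+n/1≡mkℚ : ∀ n → (ℤ.+ n) ℚ./ 1 ≡ mkℚ (ℤ.+ n) 0 (Coprime.sym (1-coprimeTo n))
+n/1≡mkℚ n = ℚ.normalize-coprime (Coprime.sym (1-coprimeTo n))

/1-mono-< : ∀ {a b} → a < b → (ℤ.+ a) ℚ./ 1 ℚ.< (ℤ.+ b) ℚ./ 1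
/1-mono-< {a} {b} a<b rewrite +n/1≡mkℚ a | +n/1≡mkℚ b =
  ℚ.*<* (subst₂ ℤ._<_ (sym (ℤ.*-identityʳ (ℤ.+ a))) (sym (ℤ.*-identityʳ (ℤ.+ b))) (ℤ.+<+ a<b))

aboveBound-of-< : ∀ d m → 4 ^ d < m * m * d → AboveBound d m
aboveBound-of-< d m lt =
  1 , subst ((ℤ.+ (4 ^ d)) ℚ./ 1 ℚ.<_) (sym (ℚ.*-identityʳ ((ℤ.+ (m * m * d)) ℚ./ 1))) (/1-mono-< lt)

aboveBound? : ∀ N d m → Dec ((ℤ.+ (4 ^ d)) ℚ./ 1 ℚ.< ((ℤ.+ (m * m * d)) ℚ./ 1) ℚ.* halfPiLower N)
aboveBound? N d m = _ ℚ.<? _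

_≟ᵛ_ : ∀ {d} → DecidableEquality (Vertex d)
_≟ᵛ_ = ≡-dec Bool._≟_

neighbours : ∀ {d} → Vertex d → List (Vertex d)
neighbours []      = []
neighbours (b ∷ x) = (not b ∷ x) ∷ map (b ∷_) (neighbours x)

closer? : ∀ {d} (y x x′ : Vertex d) → Dec (Closer y x x′)
closer? y x x′ = map′ (uncurry closer) (λ c → Closer.adjacent c , Closer.nearer c)
                      (hamming x x′ ≟ 1 ×-dec hamming x y ≟ suc (hamming x′ y))

viaNeighbour : ∀ {d} {A : Set} (x y : Vertex d) → (∀ x′ → Closer y x x′ → Maybe A) → Maybe A
viaNeighbour {d} {A} x y continue = head (mapMaybe try (neighbours x))
  where
  try : Vertex d → Maybe A
  try x′ with closer? y x x′
  ... | yes c = continue x′ c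
  ... | no  _ = nothing

route? : ∀ {d} {P : Vertex d → Set} → Decidable P → ℕ → (x y : Vertex d) → Maybe (Route P x y)
route? P? fuel x y with x ≟ᵛ y
... | yes refl = just (arrived x)
route? P? zero       x y | no _ = nothing
route? P? (suc fuel) x y | no _ with P? x
... | yes px = viaNeighbour x y λ x′ c → Maybe.map (prepend px c) (route? P? fuel x′ y)
... | no  _  = nothing

geodesic? : ∀ {d} (X : List (Vertex d)) (x y : Vertex d) → Maybe (Geodesic (_∉ X) x y)
geodesic? X x y with x ≟ᵛ y
... | yes refl = just (stationary x)
... | no  _    = viaNeighbour x y λ x′ c →
                   Maybe.map (depart c) (route? (λ v → ¬? (any? (v ≟ᵛ_) X)) (hamming x′ y) x′ y)

geodesicsFound? : ∀ {d} (X : List (Vertex d)) →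
                  Dec (All (λ x → All (λ y → T (is-just (geodesic? X x y))) X) X)
geodesicsFound? X = All.all? (λ x → All.all? (λ y → T? (is-just (geodesic? X x y))) X) X

LargeMutualVisibilitySet : (d : ℕ) → List (Vertex d) → Set
LargeMutualVisibilitySet d X = Unique X × MutualVisibility X × AboveBound d (length X)

by-computation : ∀ N {d} (X : List (Vertex d)) →
                 {True (UniqueDec.unique? _≟ᵛ_ X)} → {True (geodesicsFound? X)} →
                 {True (aboveBound? N d (length X))} →
                 LargeMutualVisibilitySet d X
by-computation N X {unique} {found} {above} =
  toWitness unique ,
  (λ x y x∈ y∈ → visible (to-witness-T (geodesic? X x y) (All.lookup (All.lookup (toWitness found) x∈) y∈))
                          id) ,
  (N , toWitness above)

middleLayers-good : ∀ d → AboveBound d (length (middleLayers d)) → LargeMutualVisibilitySet d (middleLayers d)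
middleLayers-good d above = twoLayers-unique d _ , twoLayers-mutualVisibility d _ , above

middleLayers-by-computation : ∀ N d → {True (aboveBound? N d (length (middleLayers d)))} →
                              LargeMutualVisibilitySet d (middleLayers d)
middleLayers-by-computation N d {above} = middleLayers-good d (N , toWitness above)

binary : (d : ℕ) → ℕ → Vertex d
binary zero    _ = []
binary (suc d) n = (n % 2 ≡ᵇ 1) ∷ binary d ⌊ n /2⌋

-- For d ≤ 5 two layers are too small; the explicit sets used there are verified by search.
visibleSet : (d : ℕ) → List (Vertex d)
visibleSet 1 = layer 1 0 ++ layer 1 1
visibleSet 2 = layer 2 0 ++ layer 2 1
visibleSet 3 = layer 3 0 ++ layer 3 2
visibleSet 4 = layer 4 0 ++ layer 4 2
visibleSet 5 =
  map (binary 5) (2 ∷ 3 ∷ 4 ∷ 5 ∷ 8 ∷ 9 ∷ 11 ∷ 17 ∷ 18 ∷ 22 ∷ 23 ∷ 24 ∷ 26 ∷ 28 ∷ 29 ∷ 31 ∷ [])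
visibleSet d = middleLayers d

visibleSet-good : ∀ d → 1 ≤ d → LargeMutualVisibilitySet d (visibleSet d)
visibleSet-good 1  _ = by-computation 2 (visibleSet 1)
visibleSet-good 2  _ = by-computation 1 (visibleSet 2)
visibleSet-good 3  _ = by-computation 3 (visibleSet 3)
visibleSet-good 4  _ = by-computation 2 (visibleSet 4)
visibleSet-good 5  _ = by-computation 1 (visibleSet 5)
visibleSet-good 6  _ = middleLayers-by-computation 5 6
visibleSet-good 7  _ = middleLayers-by-computation 2 7
visibleSet-good 8  _ = middleLayers-by-computation 2 8
visibleSet-good 9  _ = middleLayers-by-computation 2 9
visibleSet-good 10 _ = middleLayers-by-computation 1 10
visibleSet-good 11 _ = middleLayers-by-computation 1 11
visibleSet-good 12 _ = middleLayers-by-computation 1 12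
visibleSet-good d@(suc (suc (suc (suc (suc (suc (suc (suc (suc (suc (suc (suc (suc _))))))))))))) _ =
  middleLayers-good d (aboveBound-of-< d (length (middleLayers d)) (middleLayers-large d (m≤m+n 13 _)))

corollary3 : Σ ((d : ℕ) → List (Vertex d)) λ alg →
               (d : ℕ) → 1 ≤ d →
                 Unique (alg d) × MutualVisibility (alg d) × AboveBound d (length (alg d))
corollary3 = visibleSet , visibleSet-good
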